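{- Let $i \ge 1$ be an integer and $N = 4^i + 1$. Then there are exactly $2^{i-1}$ pairs $(A, B)$ of antipalindromic numbers with $N = A/B$.
   Context: A positive integer is antipalindromic if its base-$2$ representation (without leading zeros) $w_1 \cdots w_{2m}$ has even length and satisfies $w_i + w_{2m+1-i} = 1$ for all $i$ (the second half is the reverse complement of the first half). -}

module Defs where

open import Data.Nat using (ℕ; zero; suc; _+_; _*_; _^_; _≤_)
open import Data.Nat.Properties using ()
open import Data.Bool using (Bool; true; false; not; if_then_else_)
open import Data.List using (List; []; _∷_; foldl; length; map; reverse)
open import Data.List.Relation.Unary.Unique.Propositional using (Unique)
open import Data.List.Membership.Propositional using (_∈_)
open import Data.Product using (Σ; _×_; _,_; ∃)
open import Data.Empty using (⊥)
open import Relation.Binary.PropositionalEquality using (_≡_)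
open import Function.Bundles using (_⇔_)

fromBits : List Bool → ℕ
fromBits = foldl (λ acc b → 2 * acc + (if b then 1 else 0)) 0

IsBinaryRep : List Bool → ℕ → Set
IsBinaryRep [] n = ⊥
IsBinaryRep (b ∷ w) n = (b ≡ true) × (fromBits (b ∷ w) ≡ n)

-- antipalindromic: positive, binary representation w₁⋯w_{2m} has even length
-- and w_i + w_{2m+1-i} = 1 for all i, i.e. w equals its reverse complement
Antipalindromic : ℕ → Set
Antipalindromic n =
  Σ (List Bool) λ w → IsBinaryRep w n × (∃ λ m → length w ≡ 2 * m) × (map not (reverse w) ≡ w)

HasExactly : ℕ → (ℕ → ℕ → Set) → Set
HasExactly k P =
  Σ (List (ℕ × ℕ)) λ L → Unique L × (length L ≡ k) ×
    (∀ A B → ((A , B) ∈ L) ⇔ P A B)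

module Submission where

-- Write K = 2i, so that A = (4^i + 1) B = B 2^K + B. If B has p + 1 binary digits, A has
-- p + K + 1 or p + K + 2 of them, and as both lengths are even, exactly p + K + 1.
-- If p + 1 < K, the word of A is that of B, a block of zeros, and B again: its two middle digits
-- both lie in the zero block, contradicting the antipalindrome property.
-- If p + 1 > K, the lowest K + 1 digits of A are those of B (B ends in 0, so there is no carry),
-- hence, mirroring in A and in B, so are its top K + 1 digits; but A ≥ B 2^K + 2^p makes the
-- top digits of A strictly larger.
-- So B has exactly 2i digits, A is the word of B written twice, and B is determined by the i - 1
-- digits following its leading 1.

open import Defs
open import Data.Bool using (Bool; true; false; not; if_then_else_)
open import Data.Bool.Properties using (not-involutive)
open import Data.Empty using (⊥-elim)
open import Data.List
  using (List; []; _∷_; [_]; _++_; foldl; length; map; reverse; take; drop; cartesianProductWith)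
open import Data.List.Membership.Propositional using (_∈_)
open import Data.List.Membership.Propositional.Properties
  using (∈-map⁺; ∈-map⁻; ∈-cartesianProductWith⁺; ∈-cartesianProductWith⁻)
open import Data.List.Properties
  using (foldl-++; length-++; length-map; length-reverse; length-take; map-++; reverse-++; reverse-map;
         unfold-reverse; reverse-involutive; ++-assoc; take++drop≡id; ∷-injective; ∷-injectiveˡ; ∷-injectiveʳ)
import Data.List.Relation.Unary.All as All
import Data.List.Relation.Unary.AllPairs as AllPairs
open import Data.List.Relation.Unary.Any using (here; there)
open import Data.List.Relation.Unary.Unique.Propositional using (Unique)
open import Data.List.Relation.Unary.Unique.Propositional.Properties using (map⁺; cartesianProductWith⁺)
open import Data.Nat using (ℕ; zero; suc; _+_; _*_; _^_; _∸_; _≤_; _<_; _/_; _%_; z≤n; s≤s; z<s; s<s)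
open import Data.Nat.DivMod
open import Data.Nat.Divisibility using (_∣_; m∣m*n; ∣m⇒∣m*n; m%n≡0⇒n∣m)
open import Data.Nat.Properties
open import Data.Nat.Tactic.RingSolver using (solve-∀)
open import Data.Product using (Σ; _×_; _,_; proj₁; proj₂; map₂)
open import Data.Sum using (inj₁; inj₂)
open import Function using (_∘_)
open import Function.Bundles using (mk⇔)
open import Relation.Binary.Definitions using (tri<; tri≈; tri>)
open import Relation.Binary.PropositionalEquality hiding ([_])
open import Relation.Nullary using (¬_)

open import Algebra.Properties.CommutativeSemigroup *-commutativeSemigroup
  using (x∙yz≈y∙xz; x∙yz≈xz∙y)

-- Binary digits of natural numbers

⌊_/2^_⌋ : ℕ → ℕ → ℕ
⌊ m /2^ zero  ⌋ = m
⌊ m /2^ suc a ⌋ = ⌊ m / 2 /2^ a ⌋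

bit : ℕ → ℕ → ℕ
bit m j = ⌊ m /2^ j ⌋ % 2

[2m+n]/2≡m+n/2 : ∀ m n → (2 * m + n) / 2 ≡ m + n / 2
[2m+n]/2≡m+n/2 m n = begin
  (2 * m + n) / 2  ≡⟨ +-distrib-/-∣ˡ n (m∣m*n m) ⟩
  2 * m / 2 + n / 2 ≡⟨ cong (λ x → x / 2 + n / 2) (*-comm 2 m) ⟩
  m * 2 / 2 + n / 2 ≡⟨ cong (_+ n / 2) (m*n/n≡m m 2) ⟩
  m + n / 2         ∎
  where open ≡-Reasoning

⌊m*2^a+n/2^a⌋≡m+⌊n/2^a⌋ : ∀ a m n → ⌊ m * 2 ^ a + n /2^ a ⌋ ≡ m + ⌊ n /2^ a ⌋
⌊m*2^a+n/2^a⌋≡m+⌊n/2^a⌋ zero    m n = cong (_+ n) (*-identityʳ m)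
⌊m*2^a+n/2^a⌋≡m+⌊n/2^a⌋ (suc a) m n = begin
  ⌊ (m * (2 * 2 ^ a) + n) / 2 /2^ a ⌋  ≡⟨ cong (λ x → ⌊ (x + n) / 2 /2^ a ⌋) (x∙yz≈y∙xz m 2 (2 ^ a)) ⟩
  ⌊ (2 * (m * 2 ^ a) + n) / 2 /2^ a ⌋  ≡⟨ cong ⌊_/2^ a ⌋ ([2m+n]/2≡m+n/2 (m * 2 ^ a) n) ⟩
  ⌊ m * 2 ^ a + n / 2 /2^ a ⌋          ≡⟨ ⌊m*2^a+n/2^a⌋≡m+⌊n/2^a⌋ a m (n / 2) ⟩
  m + ⌊ n / 2 /2^ a ⌋                  ∎
  where open ≡-Reasoning

⌊m/2^a⌋≡0 : ∀ a {m} → m < 2 ^ a → ⌊ m /2^ a ⌋ ≡ 0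
⌊m/2^a⌋≡0 zero        m<1     = n<1⇒n≡0 m<1
⌊m/2^a⌋≡0 (suc a) {m} m<2^a+1 = ⌊m/2^a⌋≡0 a (m<n*o⇒m/o<n (subst (m <_) (*-comm 2 (2 ^ a)) m<2^a+1))

⌊m*2^a+n/2^a⌋≡m : ∀ a m {n} → n < 2 ^ a → ⌊ m * 2 ^ a + n /2^ a ⌋ ≡ m
⌊m*2^a+n/2^a⌋≡m a m {n} n<2^a = begin
  ⌊ m * 2 ^ a + n /2^ a ⌋ ≡⟨ ⌊m*2^a+n/2^a⌋≡m+⌊n/2^a⌋ a m n ⟩
  m + ⌊ n /2^ a ⌋         ≡⟨ cong (m +_) (⌊m/2^a⌋≡0 a n<2^a) ⟩
  m + 0                   ≡⟨ +-identityʳ m ⟩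
  m                       ∎
  where open ≡-Reasoning

⌊/2^⌋-monoˡ-≤ : ∀ a {m n} → m ≤ n → ⌊ m /2^ a ⌋ ≤ ⌊ n /2^ a ⌋
⌊/2^⌋-monoˡ-≤ zero    m≤n = m≤n
⌊/2^⌋-monoˡ-≤ (suc a) m≤n = ⌊/2^⌋-monoˡ-≤ a (/-monoˡ-≤ 2 m≤n)

⌊m/2^[a+b]⌋≡⌊⌊m/2^a⌋/2^b⌋ : ∀ a b m → ⌊ m /2^ (a + b) ⌋ ≡ ⌊ ⌊ m /2^ a ⌋ /2^ b ⌋
⌊m/2^[a+b]⌋≡⌊⌊m/2^a⌋/2^b⌋ zero    b m = refl
⌊m/2^[a+b]⌋≡⌊⌊m/2^a⌋/2^b⌋ (suc a) b m = ⌊m/2^[a+b]⌋≡⌊⌊m/2^a⌋/2^b⌋ a b (m / 2)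

m<2^[a+b]⇒⌊m/2^a⌋<2^b : ∀ a b {m} → m < 2 ^ (a + b) → ⌊ m /2^ a ⌋ < 2 ^ b
m<2^[a+b]⇒⌊m/2^a⌋<2^b zero    b m<2^b = m<2^b
m<2^[a+b]⇒⌊m/2^a⌋<2^b (suc a) b {m} m<2^a+b+1 =
  m<2^[a+b]⇒⌊m/2^a⌋<2^b a b (m<n*o⇒m/o<n (subst (m <_) (*-comm 2 (2 ^ (a + b))) m<2^a+b+1))

bit-⌊/2^⌋ : ∀ a j m → bit ⌊ m /2^ a ⌋ j ≡ bit m (a + j)
bit-⌊/2^⌋ a j m = cong (_% 2) (sym (⌊m/2^[a+b]⌋≡⌊⌊m/2^a⌋/2^b⌋ a j m))

bit-ext : ∀ t {m n} → m < 2 ^ t → n < 2 ^ t → (∀ j → j < t → bit m j ≡ bit n j) → m ≡ n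
bit-ext zero    m<1 n<1 _ = trans (n<1⇒n≡0 m<1) (sym (n<1⇒n≡0 n<1))
bit-ext (suc t) {m} {n} m<2^t+1 n<2^t+1 same = begin
  m                 ≡⟨ m≡m%n+[m/n]*n m 2 ⟩
  m % 2 + m / 2 * 2 ≡⟨ cong₂ (λ r q → r + q * 2) (same 0 z<s) halves ⟩
  n % 2 + n / 2 * 2 ≡⟨ sym (m≡m%n+[m/n]*n n 2) ⟩
  n                 ∎
  where
  open ≡-Reasoning
  halves : m / 2 ≡ n / 2
  halves = bit-ext t (m<2^[a+b]⇒⌊m/2^a⌋<2^b 1 t m<2^t+1) (m<2^[a+b]⇒⌊m/2^a⌋<2^b 1 t n<2^t+1)
                     (λ j j<t → same (suc j) (s<s j<t))

bit≡0 : ∀ j {m} → m < 2 ^ j → bit m j ≡ 0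
bit≡0 j m<2^j = cong (_% 2) (⌊m/2^a⌋≡0 j m<2^j)

2^m<2^n⇒m<n : ∀ {m n} → 2 ^ m < 2 ^ n → m < n
2^m<2^n⇒m<n 2^m<2^n = ≰⇒> (λ n≤m → <⇒≱ 2^m<2^n (^-monoʳ-≤ 2 n≤m))

2^a≤m<2^[1+b]⇒a≤b : ∀ {a b m} → 2 ^ a ≤ m → m < 2 ^ suc b → a ≤ b
2^a≤m<2^[1+b]⇒a≤b 2^a≤m m<2^b+1 = m<1+n⇒m≤n (2^m<2^n⇒m<n (≤-<-trans 2^a≤m m<2^b+1))

HasTopBit : ℕ → ℕ → Set
HasTopBit p m = 2 ^ p ≤ m × m < 2 ^ suc p

HasTopBit-unique : ∀ {p q m} → HasTopBit p m → HasTopBit q m → p ≡ q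
HasTopBit-unique (2^p≤m , m<2^p+1) (2^q≤m , m<2^q+1) =
  ≤-antisym (2^a≤m<2^[1+b]⇒a≤b 2^p≤m m<2^q+1) (2^a≤m<2^[1+b]⇒a≤b 2^q≤m m<2^p+1)

⌊2^a/2^a⌋≡1 : ∀ a → ⌊ 2 ^ a /2^ a ⌋ ≡ 1
⌊2^a/2^a⌋≡1 zero    = refl
⌊2^a/2^a⌋≡1 (suc a) = trans (cong ⌊_/2^ a ⌋ (trans (cong (_/ 2) (*-comm 2 (2 ^ a))) (m*n/n≡m (2 ^ a) 2)))
                            (⌊2^a/2^a⌋≡1 a)

HasTopBit⇒bit≡1 : ∀ {p m} → HasTopBit p m → bit m p ≡ 1
HasTopBit⇒bit≡1 {p} {m} (2^p≤m , m<2^p+1) = cong (_% 2) (≤-antisym (m<1+n⇒m≤n top<2) 1≤top)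
  where
  top<2 : ⌊ m /2^ p ⌋ < 2
  top<2 = m<2^[a+b]⇒⌊m/2^a⌋<2^b p 1 (subst (λ e → m < 2 ^ e) (+-comm 1 p) m<2^p+1)
  1≤top : 1 ≤ ⌊ m /2^ p ⌋
  1≤top = subst (_≤ ⌊ m /2^ p ⌋) (⌊2^a/2^a⌋≡1 p) (⌊/2^⌋-monoˡ-≤ p 2^p≤m)

IsBitAntipalindrome : ℕ → ℕ → Set
IsBitAntipalindrome p m = HasTopBit p m × (∀ j k → j + k ≡ p → bit m j + bit m k ≡ 1)

IsBitAntipalindrome⇒even : ∀ {p m} → IsBitAntipalindrome p m → 2 ∣ m
IsBitAntipalindrome⇒even {p} {m} (top , anti) = m%n≡0⇒n∣m m 2 (+-cancelʳ-≡ 1 (m % 2) 0 bottom+top)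
  where
  bottom+top : m % 2 + 1 ≡ 1
  bottom+top = subst (λ b → m % 2 + b ≡ 1) (HasTopBit⇒bit≡1 {p} top) (anti 0 p refl)

-- Antipalindromic multiples m * (2 ^ K + 1)

bit-[m*2^K+m] : ∀ K j {m} → 2 ∣ m → j ≤ K → bit (m * 2 ^ K + m) j ≡ bit m j
bit-[m*2^K+m] K j {m} 2∣m j≤K with m≤n⇒∃[o]m+o≡n j≤K
... | e , refl = begin
  ⌊ m * 2 ^ (j + e) + m /2^ j ⌋ % 2     ≡⟨ cong (λ x → ⌊ x + m /2^ j ⌋ % 2) m*2^[j+e]≡m*2^e*2^j ⟩
  ⌊ m * 2 ^ e * 2 ^ j + m /2^ j ⌋ % 2   ≡⟨ cong (_% 2) (⌊m*2^a+n/2^a⌋≡m+⌊n/2^a⌋ j (m * 2 ^ e) m) ⟩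
  (m * 2 ^ e + ⌊ m /2^ j ⌋) % 2         ≡⟨ %-remove-+ˡ ⌊ m /2^ j ⌋ (∣m⇒∣m*n (2 ^ e) 2∣m) ⟩
  ⌊ m /2^ j ⌋ % 2                       ∎
  where
  open ≡-Reasoning
  m*2^[j+e]≡m*2^e*2^j : m * 2 ^ (j + e) ≡ m * 2 ^ e * 2 ^ j
  m*2^[j+e]≡m*2^e*2^j = trans (cong (m *_) (^-distribˡ-+-* 2 j e)) (x∙yz≈xz∙y m (2 ^ j) (2 ^ e))

2^[p+K]≤m*2^K+m : ∀ K {p m} → 2 ^ p ≤ m → 2 ^ (p + K) ≤ m * 2 ^ K + m
2^[p+K]≤m*2^K+m K {p} {m} 2^p≤m = begin
  2 ^ (p + K)   ≡⟨ ^-distribˡ-+-* 2 p K ⟩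
  2 ^ p * 2 ^ K ≤⟨ *-monoˡ-≤ (2 ^ K) 2^p≤m ⟩
  m * 2 ^ K     ≤⟨ m≤m+n (m * 2 ^ K) m ⟩
  m * 2 ^ K + m ∎
  where open ≤-Reasoning

m*2^K+m<2^[p+K+2] : ∀ K {p m} → m < 2 ^ suc p → m * 2 ^ K + m < 2 ^ suc (suc (p + K))
m*2^K+m<2^[p+K+2] K {p} {m} m<2^p+1 = begin-strict
  m * 2 ^ K + m             ≤⟨ +-monoʳ-≤ (m * 2 ^ K) (m≤m*n m (2 ^ K) {{m^n≢0 2 K}}) ⟩
  m * 2 ^ K + m * 2 ^ K     ≡⟨ cong (m * 2 ^ K +_) (sym (+-identityʳ (m * 2 ^ K))) ⟩
  2 * (m * 2 ^ K)           <⟨ *-monoʳ-< 2 (*-monoˡ-< (2 ^ K) {{m^n≢0 2 K}} m<2^p+1) ⟩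
  2 * (2 ^ suc p * 2 ^ K)   ≡⟨ cong (2 *_) (sym (^-distribˡ-+-* 2 (suc p) K)) ⟩
  2 ^ suc (suc (p + K))     ∎
  where open ≤-Reasoning

HasTopBit-[m*2^K+m] : ∀ K {p q m} → HasTopBit p m → HasTopBit q (m * 2 ^ K + m) →
                      p + K ≤ q × q ≤ suc (p + K)
HasTopBit-[m*2^K+m] K {p} (2^p≤m , m<2^p+1) (2^q≤A , A<2^q+1) =
  2^a≤m<2^[1+b]⇒a≤b (2^[p+K]≤m*2^K+m K {p} 2^p≤m) A<2^q+1 ,
  2^a≤m<2^[1+b]⇒a≤b 2^q≤A (m*2^K+m<2^[p+K+2] K {p} m<2^p+1)

⌊m/2^c⌋<⌊[m*2^K+m]/2^[K+c]⌋ : ∀ K c {m} → 2 ^ (K + c) ≤ m →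
                              ⌊ m /2^ c ⌋ < ⌊ m * 2 ^ K + m /2^ (K + c) ⌋
⌊m/2^c⌋<⌊[m*2^K+m]/2^[K+c]⌋ K c {m} 2^[K+c]≤m = begin
  suc ⌊ m /2^ c ⌋
    ≡⟨ sym (⌊m*2^a+n/2^a⌋≡m+⌊n/2^a⌋ c 1 m) ⟩
  ⌊ 1 * 2 ^ c + m /2^ c ⌋
    ≡⟨ cong ⌊_/2^ c ⌋ (sym (⌊m*2^a+n/2^a⌋≡m K (1 * 2 ^ c + m) (m^n>0 2 K))) ⟩
  ⌊ ⌊ (1 * 2 ^ c + m) * 2 ^ K + 0 /2^ K ⌋ /2^ c ⌋
    ≡⟨ cong (λ x → ⌊ ⌊ x /2^ K ⌋ /2^ c ⌋) (rearrange (2 ^ c) (2 ^ K) m) ⟩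
  ⌊ ⌊ m * 2 ^ K + 2 ^ c * 2 ^ K /2^ K ⌋ /2^ c ⌋
    ≤⟨ ⌊/2^⌋-monoˡ-≤ c (⌊/2^⌋-monoˡ-≤ K (+-monoʳ-≤ (m * 2 ^ K) 2^c*2^K≤m)) ⟩
  ⌊ ⌊ m * 2 ^ K + m /2^ K ⌋ /2^ c ⌋
    ≡⟨ sym (⌊m/2^[a+b]⌋≡⌊⌊m/2^a⌋/2^b⌋ K c _) ⟩
  ⌊ m * 2 ^ K + m /2^ (K + c) ⌋
    ∎
  where
  open ≤-Reasoning
  rearrange : ∀ C P m → (1 * C + m) * P + 0 ≡ m * P + C * P
  rearrange = solve-∀
  2^c*2^K≤m : 2 ^ c * 2 ^ K ≤ m
  2^c*2^K≤m = subst (_≤ m) (trans (^-distribˡ-+-* 2 K c) (*-comm (2 ^ K) (2 ^ c))) 2^[K+c]≤m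

antipalindromic-multiple⇒1+p≮K : ∀ {p K m} → IsBitAntipalindrome p m →
                                 IsBitAntipalindrome (p + K) (m * 2 ^ K + m) →
                                 ¬ suc p < K
antipalindromic-multiple⇒1+p≮K {p} {m = m} m-anti@((_ , m<2^p+1) , _) (_ , A-anti) 1+p<K
  with m≤n⇒∃[o]m+o≡n 1+p<K
... | d , refl = 0≢1+n (trans (sym (cong₂ _+_ gap₁ gap₂)) (A-anti (suc p) (suc (p + d)) mirrored))
  where
  A = m * 2 ^ (suc (suc p) + d) + m
  mirrored : suc p + suc (p + d) ≡ p + (suc (suc p) + d)
  mirrored = sym (+-suc p (suc (p + d)))
  2∣m : 2 ∣ m
  2∣m = IsBitAntipalindrome⇒even m-anti
  gap₁ : bit A (suc p) ≡ 0
  gap₁ = trans (bit-[m*2^K+m] _ (suc p) 2∣m (≤-trans (n≤1+n (suc p)) (m≤m+n (suc (suc p)) d)))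
               (bit≡0 (suc p) m<2^p+1)
  gap₂ : bit A (suc (p + d)) ≡ 0
  gap₂ = trans (bit-[m*2^K+m] _ (suc (p + d)) 2∣m (n≤1+n (suc (p + d))))
               (bit≡0 (suc (p + d)) (<-≤-trans m<2^p+1 (^-monoʳ-≤ 2 (s≤s (m≤m+n p d)))))

antipalindromic-multiple⇒K≰p : ∀ {p K m} → IsBitAntipalindrome p m →
                               IsBitAntipalindrome (p + K) (m * 2 ^ K + m) →
                               ¬ K ≤ p
antipalindromic-multiple⇒K≰p {K = K} {m} m-anti@((2^p≤m , m<2^p+1) , m-bits) ((_ , A<2^q+1) , A-bits) K≤p
  with m≤n⇒∃[o]m+o≡n K≤p
... | c , refl = n≮n ⌊ m /2^ c ⌋
                   (subst (⌊ m /2^ c ⌋ <_) top-bits-agree (⌊m/2^c⌋<⌊[m*2^K+m]/2^[K+c]⌋ K c 2^p≤m))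
  where
  A = m * 2 ^ K + m
  2∣m : 2 ∣ m
  2∣m = IsBitAntipalindrome⇒even m-anti
  same-bits : ∀ j → j < suc K → bit ⌊ A /2^ (K + c) ⌋ j ≡ bit ⌊ m /2^ c ⌋ j
  same-bits j j<1+K with m≤n⇒∃[o]m+o≡n (m<1+n⇒m≤n j<1+K)
  ... | e , j+e≡K = begin
    bit ⌊ A /2^ (K + c) ⌋ j ≡⟨ bit-⌊/2^⌋ (K + c) j A ⟩
    bit A (K + c + j)       ≡⟨ +-cancelʳ-≡ (bit m e) _ _ (trans A-pair (sym m-pair)) ⟩
    bit m (c + j)           ≡⟨ sym (bit-⌊/2^⌋ c j m) ⟩
    bit ⌊ m /2^ c ⌋ j       ∎
    where
    open ≡-Reasoning
    A-pair : bit A (K + c + j) + bit m e ≡ 1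
    A-pair = subst (λ b → bit A (K + c + j) + b ≡ 1)
                   (bit-[m*2^K+m] K e 2∣m (subst (e ≤_) j+e≡K (m≤n+m e j)))
                   (A-bits (K + c + j) e (trans (+-assoc (K + c) j e) (cong (K + c +_) j+e≡K)))
    m-pair : bit m (c + j) + bit m e ≡ 1
    m-pair = m-bits (c + j) e (trans (+-assoc c j e) (trans (cong (c +_) j+e≡K) (+-comm c K)))
  top-bits-agree : ⌊ A /2^ (K + c) ⌋ ≡ ⌊ m /2^ c ⌋
  top-bits-agree = bit-ext (suc K)
    (m<2^[a+b]⇒⌊m/2^a⌋<2^b (K + c) (suc K) (subst (λ e → A < 2 ^ e) (sym (+-suc (K + c) K)) A<2^q+1))
    (m<2^[a+b]⇒⌊m/2^a⌋<2^b c (suc K) (subst (λ e → m < 2 ^ e) 1+K+c≡c+1+K m<2^p+1))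
    same-bits
    where
    1+K+c≡c+1+K : suc (K + c) ≡ c + suc K
    1+K+c≡c+1+K = trans (cong suc (+-comm K c)) (sym (+-suc c K))

antipalindromic-multiple⇒1+p≡K : ∀ {p K m} → IsBitAntipalindrome p m →
                                 IsBitAntipalindrome (p + K) (m * 2 ^ K + m) →
                                 suc p ≡ K
antipalindromic-multiple⇒1+p≡K {p} {K} m-anti A-anti with <-cmp (suc p) K
... | tri< 1+p<K _ _ = ⊥-elim (antipalindromic-multiple⇒1+p≮K m-anti A-anti 1+p<K)
... | tri≈ _ 1+p≡K _ = 1+p≡K
... | tri> _ _ K<1+p = ⊥-elim (antipalindromic-multiple⇒K≰p m-anti A-anti (m<1+n⇒m≤n K<1+p))

-- Binary words

toℕ : Bool → ℕ
toℕ b = if b then 1 else 0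

toℕ-injective : ∀ {b c} → toℕ b ≡ toℕ c → b ≡ c
toℕ-injective {false} {false} _ = refl
toℕ-injective {true}  {true}  _ = refl

toℕ-complement : ∀ b → toℕ b + toℕ (not b) ≡ 1
toℕ-complement false = refl
toℕ-complement true  = refl

toℕ[b]%2≡toℕ[b] : ∀ b → toℕ b % 2 ≡ toℕ b
toℕ[b]%2≡toℕ[b] false = refl
toℕ[b]%2≡toℕ[b] true  = refl

toℕ[b]*n≤n : ∀ b n → toℕ b * n ≤ n
toℕ[b]*n≤n false n = z≤n
toℕ[b]*n≤n true  n = ≤-reflexive (+-identityʳ n)

fromBits-acc : ∀ a w → foldl (λ acc b → 2 * acc + toℕ b) a w ≡ a * 2 ^ length w + fromBits w
fromBits-acc a []      = sym (trans (cong (_+ 0) (*-identityʳ a)) (+-identityʳ a))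
fromBits-acc a (b ∷ w) = begin
  foldl _ (2 * a + toℕ b) w
    ≡⟨ fromBits-acc (2 * a + toℕ b) w ⟩
  (2 * a + toℕ b) * 2 ^ length w + fromBits w
    ≡⟨ shift-digit a (toℕ b) (2 ^ length w) (fromBits w) ⟩
  a * 2 ^ suc (length w) + (toℕ b * 2 ^ length w + fromBits w)
    ≡⟨ cong (a * 2 ^ suc (length w) +_) (sym (fromBits-acc (toℕ b) w)) ⟩
  a * 2 ^ suc (length w) + fromBits (b ∷ w)
    ∎
  where
  open ≡-Reasoning
  shift-digit : ∀ a t P F → (2 * a + t) * P + F ≡ a * (2 * P) + (t * P + F)
  shift-digit = solve-∀

fromBits-∷ : ∀ b w → fromBits (b ∷ w) ≡ toℕ b * 2 ^ length w + fromBits w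
fromBits-∷ b w = fromBits-acc (toℕ b) w

fromBits-++ : ∀ x y → fromBits (x ++ y) ≡ fromBits x * 2 ^ length y + fromBits y
fromBits-++ x y = trans (foldl-++ _ 0 x y) (fromBits-acc (fromBits x) y)

fromBits<2^length : ∀ w → fromBits w < 2 ^ length w
fromBits<2^length []      = z<s
fromBits<2^length (b ∷ w) = begin-strict
  fromBits (b ∷ w)                           ≡⟨ fromBits-∷ b w ⟩
  toℕ b * 2 ^ length w + fromBits w          <⟨ +-monoʳ-< (toℕ b * 2 ^ length w) (fromBits<2^length w) ⟩
  toℕ b * 2 ^ length w + 2 ^ length w        ≤⟨ +-monoˡ-≤ (2 ^ length w) (toℕ[b]*n≤n b (2 ^ length w)) ⟩
  2 ^ length w + 2 ^ length w                ≡⟨ cong (2 ^ length w +_) (sym (+-identityʳ (2 ^ length w))) ⟩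
  2 ^ length (b ∷ w)                         ∎
  where open ≤-Reasoning

fromBits-HasTopBit : ∀ u → HasTopBit (length u) (fromBits (true ∷ u))
fromBits-HasTopBit u = lower , fromBits<2^length (true ∷ u)
  where
  lower : 2 ^ length u ≤ fromBits (true ∷ u)
  lower = begin
    2 ^ length u                 ≡⟨ sym (*-identityˡ (2 ^ length u)) ⟩
    1 * 2 ^ length u             ≤⟨ m≤m+n _ (fromBits u) ⟩
    1 * 2 ^ length u + fromBits u ≡⟨ sym (fromBits-∷ true u) ⟩
    fromBits (true ∷ u)          ∎
    where open ≤-Reasoning

bit-fromBits : ∀ x b y → bit (fromBits (x ++ b ∷ y)) (length y) ≡ toℕ b
bit-fromBits x b y = begin
  ⌊ fromBits (x ++ b ∷ y) /2^ length y ⌋ % 2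
    ≡⟨ cong (λ n → ⌊ n /2^ length y ⌋ % 2) digits ⟩
  ⌊ (2 * fromBits x + toℕ b) * 2 ^ length y + fromBits y /2^ length y ⌋ % 2
    ≡⟨ cong (_% 2) (⌊m*2^a+n/2^a⌋≡m (length y) (2 * fromBits x + toℕ b) (fromBits<2^length y)) ⟩
  (2 * fromBits x + toℕ b) % 2
    ≡⟨ %-remove-+ˡ (toℕ b) (m∣m*n (fromBits x)) ⟩
  toℕ b % 2
    ≡⟨ toℕ[b]%2≡toℕ[b] b ⟩
  toℕ b
    ∎
  where
  open ≡-Reasoning
  regroup : ∀ X t P F → X * (2 * P) + (t * P + F) ≡ (2 * X + t) * P + F
  regroup = solve-∀
  digits : fromBits (x ++ b ∷ y) ≡ (2 * fromBits x + toℕ b) * 2 ^ length y + fromBits y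
  digits = trans (fromBits-++ x (b ∷ y))
                 (trans (cong (fromBits x * 2 ^ length (b ∷ y) +_) (fromBits-∷ b y))
                        (regroup (fromBits x) (toℕ b) (2 ^ length y) (fromBits y)))

fromBits-injective : ∀ {v w} → length v ≡ length w → fromBits v ≡ fromBits w → v ≡ w
fromBits-injective {[]}    {[]}    _        _  = refl
fromBits-injective {b ∷ v} {c ∷ w} |bv|≡|cw| eq = cong₂ _∷_ b≡c (fromBits-injective |v|≡|w| tails)
  where
  |v|≡|w| : length v ≡ length w
  |v|≡|w| = suc-injective |bv|≡|cw|
  eq′ : toℕ b * 2 ^ length v + fromBits v ≡ toℕ c * 2 ^ length v + fromBits w
  eq′ = trans (sym (fromBits-∷ b v))
              (trans eq (trans (fromBits-∷ c w) (cong (λ n → toℕ c * 2 ^ n + fromBits w) (sym |v|≡|w|))))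
  b≡c : b ≡ c
  b≡c = toℕ-injective (begin
    toℕ b
      ≡⟨ sym (⌊m*2^a+n/2^a⌋≡m (length v) (toℕ b) (fromBits<2^length v)) ⟩
    ⌊ toℕ b * 2 ^ length v + fromBits v /2^ length v ⌋
      ≡⟨ cong ⌊_/2^ length v ⌋ eq′ ⟩
    ⌊ toℕ c * 2 ^ length v + fromBits w /2^ length v ⌋
      ≡⟨ ⌊m*2^a+n/2^a⌋≡m (length v) (toℕ c) (subst (λ n → fromBits w < 2 ^ n) (sym |v|≡|w|) (fromBits<2^length w)) ⟩
    toℕ c
      ∎)
    where open ≡-Reasoning
  tails : fromBits v ≡ fromBits w
  tails = +-cancelˡ-≡ (toℕ b * 2 ^ length v) _ _
                      (trans eq′ (cong (λ d → toℕ d * 2 ^ length v + fromBits w) (sym b≡c)))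

IsBinaryRep-unique : ∀ {v w n} → IsBinaryRep v n → IsBinaryRep w n → v ≡ w
IsBinaryRep-unique {_ ∷ v} {_ ∷ w} (refl , refl) (refl , eq) =
  fromBits-injective (cong suc |v|≡|w|) (sym eq)
  where
  |v|≡|w| : length v ≡ length w
  |v|≡|w| = HasTopBit-unique (fromBits-HasTopBit v) (subst (HasTopBit (length w)) eq (fromBits-HasTopBit w))

-- Antipalindromic words

rc : List Bool → List Bool
rc w = map not (reverse w)

length-rc : ∀ w → length (rc w) ≡ length w
length-rc w = trans (length-map not (reverse w)) (length-reverse w)

rc-++ : ∀ x y → rc (x ++ y) ≡ rc y ++ rc x
rc-++ x y = trans (cong (map not) (reverse-++ x y)) (map-++ not (reverse y) (reverse x))

rc-∷ : ∀ b w → rc (b ∷ w) ≡ rc w ++ [ not b ]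
rc-∷ b w = trans (cong (map not) (unfold-reverse b w)) (map-++ not (reverse w) [ b ])

rc-involutive : ∀ w → rc (rc w) ≡ w
rc-involutive w = begin
  map not (reverse (map not (reverse w))) ≡⟨ cong (map not) (sym (reverse-map not (reverse w))) ⟩
  map not (map not (reverse (reverse w))) ≡⟨ cong (λ v → map not (map not v)) (reverse-involutive w) ⟩
  map not (map not w)                     ≡⟨ map-not-involutive w ⟩
  w                                       ∎
  where
  open ≡-Reasoning
  map-not-involutive : ∀ w → map not (map not w) ≡ w
  map-not-involutive []      = refl
  map-not-involutive (b ∷ w) = cong₂ _∷_ (not-involutive b) (map-not-involutive w)

split-from-end : ∀ {A : Set} (w : List A) {j} → j < length w →
                 Σ (List A) λ x → Σ A λ b → Σ (List A) λ y → w ≡ x ++ b ∷ y × length y ≡ j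
split-from-end (c ∷ w) j<1+|w| with m<1+n⇒m<n∨m≡n j<1+|w|
... | inj₁ j<|w| with split-from-end w j<|w|
...   | x , b , y , refl , |y|≡j = c ∷ x , b , y , refl , |y|≡j
split-from-end (c ∷ w) _ | inj₂ refl = [] , c , w , refl , refl

-- Splitting w = x ++ b ∷ y at bit j, the reverse complement splits as rc y ++ not b ∷ rc x at bit k.
rc-fixed⇒IsBitAntipalindrome : ∀ u → rc (true ∷ u) ≡ true ∷ u →
                               IsBitAntipalindrome (length u) (fromBits (true ∷ u))
rc-fixed⇒IsBitAntipalindrome u fixed = fromBits-HasTopBit u , mirror
  where
  w = true ∷ u
  mirror : ∀ j k → j + k ≡ length u → bit (fromBits w) j + bit (fromBits w) k ≡ 1
  mirror j k j+k≡p with split-from-end w {j} (s≤s (subst (j ≤_) j+k≡p (m≤m+n j k)))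
  ... | x , b , y , w≡xby , |y|≡j =
    trans (cong₂ _+_ bit-j bit-k) (toℕ-complement b)
    where
    open ≡-Reasoning
    |x|≡k : length x ≡ k
    |x|≡k = +-cancelʳ-≡ (suc j) (length x) k (begin
      length x + suc j          ≡⟨ cong (λ i → length x + suc i) (sym |y|≡j) ⟩
      length x + length (b ∷ y) ≡⟨ sym (length-++ x) ⟩
      length (x ++ b ∷ y)       ≡⟨ cong length (sym w≡xby) ⟩
      suc (length u)            ≡⟨ cong suc (trans (sym j+k≡p) (+-comm j k)) ⟩
      suc (k + j)               ≡⟨ sym (+-suc k j) ⟩
      k + suc j                 ∎)
    w≡rc-split : w ≡ rc y ++ not b ∷ rc x
    w≡rc-split = begin
      w                          ≡⟨ sym fixed ⟩
      rc w                       ≡⟨ cong rc w≡xby ⟩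
      rc (x ++ b ∷ y)            ≡⟨ rc-++ x (b ∷ y) ⟩
      rc (b ∷ y) ++ rc x         ≡⟨ cong (_++ rc x) (rc-∷ b y) ⟩
      (rc y ++ [ not b ]) ++ rc x ≡⟨ ++-assoc (rc y) [ not b ] (rc x) ⟩
      rc y ++ not b ∷ rc x       ∎
    bit-j : bit (fromBits w) j ≡ toℕ b
    bit-j = subst₂ (λ v i → bit (fromBits v) i ≡ toℕ b) (sym w≡xby) |y|≡j (bit-fromBits x b y)
    bit-k : bit (fromBits w) k ≡ toℕ (not b)
    bit-k = subst₂ (λ v i → bit (fromBits v) i ≡ toℕ (not b)) (sym w≡rc-split) (trans (length-rc x) |x|≡k)
                   (bit-fromBits (rc y) (not b) (rc x))

++-injective : ∀ {A : Set} (x y : List A) {z w} → length x ≡ length y → x ++ z ≡ y ++ w → x ≡ y × z ≡ w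
++-injective []      []      _        eq = refl , eq
++-injective (a ∷ x) (b ∷ y) |ax|≡|by| eq with ∷-injective eq
... | refl , eq′ with ++-injective x y (suc-injective |ax|≡|by|) eq′
...   | refl , z≡w = refl , z≡w

rc-fixed⇒≡half++rc-half : ∀ n {w} → rc w ≡ w → length w ≡ n + n →
                          Σ (List Bool) λ x → length x ≡ n × w ≡ x ++ rc x
rc-fixed⇒≡half++rc-half n {w} fixed |w|≡n+n =
  x , |x|≡n , trans (sym (take++drop≡id n w)) (cong (x ++_) y≡rc-x)
  where
  x = take n w
  y = drop n w
  |x|≡n : length x ≡ n
  |x|≡n = trans (length-take n w) (m≤n⇒m⊓n≡m (subst (n ≤_) (sym |w|≡n+n) (m≤m+n n n)))
  |y|≡n : length y ≡ n
  |y|≡n = +-cancelˡ-≡ n (length y) n (begin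
    n + length y        ≡⟨ cong (_+ length y) (sym |x|≡n) ⟩
    length x + length y ≡⟨ sym (length-++ x) ⟩
    length (x ++ y)     ≡⟨ cong length (take++drop≡id n w) ⟩
    length w            ≡⟨ |w|≡n+n ⟩
    n + n               ∎)
    where open ≡-Reasoning
  rc-y++rc-x≡x++y : rc y ++ rc x ≡ x ++ y
  rc-y++rc-x≡x++y = begin
    rc y ++ rc x ≡⟨ sym (rc-++ x y) ⟩
    rc (x ++ y)  ≡⟨ cong rc (take++drop≡id n w) ⟩
    rc w         ≡⟨ fixed ⟩
    w            ≡⟨ sym (take++drop≡id n w) ⟩
    x ++ y       ∎
    where open ≡-Reasoning
  y≡rc-x : y ≡ rc x
  y≡rc-x = sym (proj₂ (++-injective (rc y) x (trans (length-rc y) (trans |y|≡n (sym |x|≡n))) rc-y++rc-x≡x++y))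

antipalindrome : List Bool → List Bool
antipalindrome u = (true ∷ u) ++ rc (true ∷ u)

rc-antipalindrome : ∀ u → rc (antipalindrome u) ≡ antipalindrome u
rc-antipalindrome u =
  trans (rc-++ (true ∷ u) (rc (true ∷ u))) (cong (_++ rc (true ∷ u)) (rc-involutive (true ∷ u)))

length-antipalindrome : ∀ u → length (antipalindrome u) ≡ 2 * suc (length u)
length-antipalindrome u = begin
  length (antipalindrome u)                       ≡⟨ length-++ (true ∷ u) ⟩
  suc (length u) + length (rc (true ∷ u))         ≡⟨ cong (suc (length u) +_) (length-rc (true ∷ u)) ⟩
  suc (length u) + suc (length u)                 ≡⟨ cong (suc (length u) +_) (sym (+-identityʳ (suc (length u)))) ⟩
  2 * suc (length u)                              ∎
  where open ≡-Reasoning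

antipalindrome-Antipalindromic : ∀ u → Antipalindromic (fromBits (antipalindrome u))
antipalindrome-Antipalindromic u =
  antipalindrome u , (refl , refl) , (suc (length u) , length-antipalindrome u) , rc-antipalindrome u

antipalindrome-injective : ∀ {u v} → fromBits (antipalindrome u) ≡ fromBits (antipalindrome v) → u ≡ v
antipalindrome-injective {u} {v} eq =
  ∷-injectiveʳ (proj₁ (++-injective (true ∷ u) (true ∷ v) (cong suc |u|≡|v|) words-equal))
  where
  words-equal : antipalindrome u ≡ antipalindrome v
  words-equal = IsBinaryRep-unique {antipalindrome u} (refl , refl) (refl , sym eq)
  |u|≡|v| : length u ≡ length v
  |u|≡|v| = suc-injective (*-cancelˡ-≡ (suc (length u)) (suc (length v)) 2
    (trans (sym (length-antipalindrome u)) (trans (cong length words-equal) (length-antipalindrome v))))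

rc-fixed⇒≡antipalindrome : ∀ k {v} → rc (true ∷ v) ≡ true ∷ v → length (true ∷ v) ≡ 2 * suc k →
                           Σ (List Bool) λ u → length u ≡ k × true ∷ v ≡ antipalindrome u
rc-fixed⇒≡antipalindrome k fixed |w|≡2k+2
  with rc-fixed⇒≡half++rc-half (suc k) fixed (trans |w|≡2k+2 (cong (suc k +_) (+-identityʳ (suc k))))
... | c ∷ u , |cu|≡1+k , w≡ with ∷-injectiveˡ w≡
...   | refl = u , suc-injective |cu|≡1+k , w≡

words : ℕ → List (List Bool)
words zero    = [ [] ]
words (suc n) = cartesianProductWith _∷_ (true ∷ false ∷ []) (words n)

length-words : ∀ n → length (words n) ≡ 2 ^ n
length-words zero    = refl
length-words (suc n) = begin
  length (map (true ∷_) (words n) ++ (map (false ∷_) (words n) ++ []))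
    ≡⟨ length-++ (map (true ∷_) (words n)) ⟩
  length (map (true ∷_) (words n)) + length (map (false ∷_) (words n) ++ [])
    ≡⟨ cong₂ _+_ (length-map (true ∷_) (words n))
                 (trans (length-++ (map (false ∷_) (words n))) (cong (_+ 0) (length-map (false ∷_) (words n)))) ⟩
  length (words n) + (length (words n) + 0)
    ≡⟨ cong (λ l → l + (l + 0)) (length-words n) ⟩
  2 * 2 ^ n ∎
  where open ≡-Reasoning

words-unique : ∀ n → Unique (words n)
words-unique zero    = All.[] AllPairs.∷ AllPairs.[]
words-unique (suc n) = cartesianProductWith⁺ _∷_ ∷-injective bools-unique (words-unique n)
  where
  bools-unique : Unique (true ∷ false ∷ [])
  bools-unique = ((λ ()) All.∷ All.[]) AllPairs.∷ (All.[] AllPairs.∷ AllPairs.[])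

∈-words : ∀ u → u ∈ words (length u)
∈-words []      = here refl
∈-words (b ∷ u) = ∈-cartesianProductWith⁺ _∷_ (∈-bools b) (∈-words u)
  where
  ∈-bools : ∀ b → b ∈ true ∷ false ∷ []
  ∈-bools true  = here refl
  ∈-bools false = there (here refl)

∈-words⇒length : ∀ n {u} → u ∈ words n → length u ≡ n
∈-words⇒length zero    (here refl) = refl
∈-words⇒length (suc n) u∈words with ∈-cartesianProductWith⁻ _∷_ (true ∷ false ∷ []) (words n) u∈words
... | _ , v , _ , v∈words , refl = cong suc (∈-words⇒length n v∈words)

[4^i+1]*m≡m*2^[2i]+m : ∀ i m → (4 ^ i + 1) * m ≡ m * 2 ^ (2 * i) + m
[4^i+1]*m≡m*2^[2i]+m i m = trans (cong (λ P → (P + 1) * m) (^-*-assoc 2 2 i)) (distribute (2 ^ (2 * i)) m)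
  where
  distribute : ∀ P m → (P + 1) * m ≡ m * P + m
  distribute = solve-∀

antipalindromic-quotient-length :
  ∀ k {a b m n} → rc (true ∷ a) ≡ true ∷ a → length (true ∷ a) ≡ 2 * m →
                  rc (true ∷ b) ≡ true ∷ b → length (true ∷ b) ≡ 2 * n →
  fromBits (true ∷ a) ≡ fromBits (true ∷ b) * 2 ^ (2 * k) + fromBits (true ∷ b) →
  length (true ∷ b) ≡ 2 * k
antipalindromic-quotient-length k {a} {b} {m} {n} a-fixed |a|≡2m b-fixed |b|≡2n eq =
  antipalindromic-multiple⇒1+p≡K {length b} b-anti (subst (λ q → IsBitAntipalindrome q A) q≡p+K a-anti)
  where
  B = fromBits (true ∷ b)
  K = 2 * k
  A = B * 2 ^ K + B
  b-anti : IsBitAntipalindrome (length b) B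
  b-anti = rc-fixed⇒IsBitAntipalindrome b b-fixed
  a-anti : IsBitAntipalindrome (length a) A
  a-anti = subst (IsBitAntipalindrome (length a)) eq (rc-fixed⇒IsBitAntipalindrome a a-fixed)
  q≡p+K : length a ≡ length b + K
  q≡p+K with HasTopBit-[m*2^K+m] K {length b} (proj₁ b-anti) (proj₁ a-anti)
  ... | p+K≤q , q≤1+p+K with m≤n⇒m<n∨m≡n q≤1+p+K
  ...   | inj₁ q<1+p+K = ≤-antisym (m<1+n⇒m≤n q<1+p+K) p+K≤q
  ...   | inj₂ q≡1+p+K = ⊥-elim (even≢odd m (n + k) (begin
    2 * m                  ≡⟨ sym |a|≡2m ⟩
    suc (length a)         ≡⟨ cong suc q≡1+p+K ⟩
    suc (suc (length b) + K) ≡⟨ cong (λ l → suc (l + K)) |b|≡2n ⟩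
    suc (2 * n + 2 * k)    ≡⟨ cong suc (sym (*-distribˡ-+ 2 n k)) ⟩
    suc (2 * (n + k))      ∎))
    where open ≡-Reasoning

[4^i+1]*antipalindrome : ∀ u → (4 ^ suc (length u) + 1) * fromBits (antipalindrome u) ≡
                                 fromBits (antipalindrome (u ++ rc (true ∷ u)))
[4^i+1]*antipalindrome u = begin
  (4 ^ suc (length u) + 1) * B      ≡⟨ [4^i+1]*m≡m*2^[2i]+m (suc (length u)) B ⟩
  B * 2 ^ (2 * suc (length u)) + B  ≡⟨ cong (λ l → B * 2 ^ l + B) (sym (length-antipalindrome u)) ⟩
  B * 2 ^ length w + B              ≡⟨ sym (fromBits-++ w w) ⟩
  fromBits (w ++ w)                 ≡⟨ cong (λ v → fromBits (w ++ v)) (sym (rc-antipalindrome u)) ⟩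
  fromBits (w ++ rc w)              ∎
  where
  open ≡-Reasoning
  w = antipalindrome u
  B = fromBits w

antipalindromic-quotient⇒≡antipalindrome :
  ∀ k {A B} → Antipalindromic A → Antipalindromic B → A ≡ (4 ^ suc k + 1) * B →
  Σ (List Bool) λ u → length u ≡ k × B ≡ fromBits (antipalindrome u)
antipalindromic-quotient⇒≡antipalindrome k
  (true ∷ a , (refl , refl) , (m , |a|≡2m) , a-fixed)
  (true ∷ b , (refl , refl) , (n , |b|≡2n) , b-fixed) A≡NB =
  map₂ (map₂ (cong fromBits)) (rc-fixed⇒≡antipalindrome k b-fixed |b|≡2k+2)
  where
  |b|≡2k+2 : length (true ∷ b) ≡ 2 * suc k
  |b|≡2k+2 = antipalindromic-quotient-length (suc k) {m = m} {n = n} a-fixed |a|≡2m b-fixed |b|≡2n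
               (trans A≡NB ([4^i+1]*m≡m*2^[2i]+m (suc k) (fromBits (true ∷ b))))

theorem21 : (i : ℕ) → 1 ≤ i →
    HasExactly (2 ^ (i ∸ 1))
      (λ A B → Antipalindromic A × Antipalindromic B × (A ≡ (4 ^ i + 1) * B))
theorem21 (suc k) _ =
  map pair (words k) , map⁺ (antipalindrome-injective ∘ cong proj₂) (words-unique k) ,
  trans (length-map pair (words k)) (length-words k) , λ A B → mk⇔ (sound A B) (complete A B)
  where
  N = 4 ^ suc k + 1
  pair : List Bool → ℕ × ℕ
  pair u = N * fromBits (antipalindrome u) , fromBits (antipalindrome u)

  sound : ∀ A B → (A , B) ∈ map pair (words k) → Antipalindromic A × Antipalindromic B × A ≡ N * B
  sound _ _ pair∈ with ∈-map⁻ pair pair∈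
  ... | u , u∈words , refl =
    subst (λ l → Antipalindromic ((4 ^ suc l + 1) * fromBits (antipalindrome u))) (∈-words⇒length k u∈words)
          (subst Antipalindromic (sym ([4^i+1]*antipalindrome u))
                 (antipalindrome-Antipalindromic (u ++ rc (true ∷ u)))) ,
    antipalindrome-Antipalindromic u , refl

  complete : ∀ A B → Antipalindromic A × Antipalindromic B × A ≡ N * B → (A , B) ∈ map pair (words k)
  complete A B (A-anti , B-anti , A≡NB) =
    member (antipalindromic-quotient⇒≡antipalindrome k A-anti B-anti A≡NB)
    where
    member : Σ (List Bool) (λ u → length u ≡ k × B ≡ fromBits (antipalindrome u)) →
             (A , B) ∈ map pair (words k)
    member (u , |u|≡k , B≡) =
      subst (_∈ map pair (words k)) (sym (cong₂ _,_ (trans A≡NB (cong (N *_) B≡)) B≡))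
            (∈-map⁺ pair (subst (λ l → u ∈ words l) |u|≡k (∈-words u)))
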